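{- Let $\ell\ge5$ be a prime and $k\in\mathbb Z$, and let $\mathcal M_k(\mathbb Z[1/\ell])=\{(u_1,u_2,u_3)\in\mathbb Z[1/\ell]^3: u_1^2+u_2^2+u_3^2-u_1u_2u_3=k\}$. Suppose $\mathcal M_k(\mathbb Z[1/\ell])$ is nonempty. Then either it contains a point of $\mathbb Z^3$, or it contains a point of the form $(x_1,x_2/\ell^a,x_3/\ell^a)$ with $x_1,x_2,x_3\in\mathbb Z$, $\ell\nmid x_2x_3$ and $a\ge1$. -}

module Defs where

open import Data.Nat as ℕ using (ℕ)
open import Data.Integer as ℤ using (ℤ; +_)
open import Data.Rational using (ℚ; _/_; _+_; _*_; _-_)
open import Data.Product using (_×_; ∃-syntax)
open import Relation.Binary.PropositionalEquality using (_≡_)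

ofℤ : ℤ → ℚ
ofℤ z = z / 1

pow : ℕ → ℕ → ℚ
pow ℓ e = ofℤ (+ (ℓ ℕ.^ e))

InZ[1/_] : ℕ → ℚ → Set
InZ[1/ ℓ ] q = ∃[ e ] ∃[ x ] (pow ℓ e * q ≡ ofℤ x)

MarkoffEq : ℤ → ℚ → ℚ → ℚ → Set
MarkoffEq k u₁ u₂ u₃ = (u₁ * u₁ + u₂ * u₂ + u₃ * u₃) - u₁ * u₂ * u₃ ≡ ofℤ k

InM : ℕ → ℤ → ℚ → ℚ → ℚ → Set
InM ℓ k u₁ u₂ u₃ =
  InZ[1/ ℓ ] u₁ × InZ[1/ ℓ ] u₂ × InZ[1/ ℓ ] u₃ × MarkoffEq k u₁ u₂ u₃

{-# OPTIONS --safe #-}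
-- Write each coordinate in lowest terms as xᵢ/ℓ^dᵢ (so ℓ ∤ xᵢ when dᵢ ≥ 1) and order d₁ ≥ d₂ ≥ d₃.
-- After clearing denominators, comparing the ℓ-adic valuations of the terms shows that
-- d₁ > d₂ + d₃ forces ℓ ∣ x₁ and d₁ < d₂ + d₃ forces ℓ ∣ x₁x₂x₃, both impossible. Hence
-- d₁ = d₂ + d₃. If d₃ = 0, the point is integral (d₂ = 0) or has the required shape (d₁ = d₂ ≥ 1).
-- Otherwise ℓ ∣ x₁(x₂x₃ - x₁), so ℓ ∣ x₂x₃ - x₁, and the Vieta involution u₁ ↦ u₂u₃ - u₁ gives a
-- solution with smaller d₁ + d₂ + d₃; descend.
module Submission where

open import Defs
open import Data.Empty using (⊥; ⊥-elim)
open import Data.List.Base using (_∷_; [])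
open import Relation.Nullary.Decidable using (dec⇒maybe)
open import Data.Nat as ℕ using (ℕ; zero; suc; _≤_; _≥_; _<_; z≤n; s≤s)
import Data.Nat.Properties as ℕ
import Data.Nat.Divisibility as ℕ
import Data.Nat.Coprimality as Coprimality
open import Data.Nat.Primality using (Prime; euclidsLemma; prime⇒nonZero)
open import Data.Nat.Induction using (<-wellFounded)
open import Algebra.Properties.CommutativeSemigroup ℕ.+-commutativeSemigroup
  using (xy∙z≈yx∙z; xy∙z≈xz∙y; xy∙z≈yz∙x)
open import Data.Integer as ℤ using (ℤ; +_; +0; +[1+_]; -[1+_]; 0ℤ)
import Data.Integer.Properties as ℤ
open import Data.Integer.Divisibility using (_∣_)
import Data.Integer.Divisibility.Signed as Signed
import Data.Rational as ℚ
import Data.Rational.Properties as ℚ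
open import Data.Product using (Σ; _×_; _,_; proj₁; proj₂; ∃-syntax; map₂)
open import Data.Sum as Sum using (_⊎_; inj₁; inj₂)
open import Induction.WellFounded using (WellFounded; module All)
open import Level using (0ℓ)
import Relation.Binary.Construct.On as On
open import Relation.Binary.Definitions using (tri<; tri≈; tri>)
open import Relation.Binary.PropositionalEquality
  using (_≡_; _≢_; refl; sym; trans; cong; cong₂; subst; module ≡-Reasoning)
open import Relation.Nullary using (¬_; yes; no)
import Tactic.RingSolver as RingSolver
open import Tactic.RingSolver.Core.AlmostCommutativeRing
  using (AlmostCommutativeRing; fromCommutativeRing)

-- The equation is passed first so that its two sides are known when the
-- solver macros producing the other two arguments are run.
reshape : ∀ {A : Set} {a b c d : A} → b ≡ c → a ≡ b → c ≡ d → a ≡ d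
reshape b≡c a≡b c≡d = trans a≡b (trans b≡c c≡d)

module ClearedEquation where
  open import Data.Integer.Base using (_+_; _*_; _-_)
  open import Data.Integer.Tactic.RingSolver using (solve)

  -- The Markoff equation for (x₁/p₁, x₂/p₂, x₃/p₃) multiplied by (p₁p₂p₃)²; a record
  -- rather than a type synonym so that its arguments can be inferred.
  record ClearedMarkoffEq (k x₁ p₁ x₂ p₂ x₃ p₃ : ℤ) : Set where
    constructor cleared
    field
      equation :
        (x₁ * p₂ * p₃) * (x₁ * p₂ * p₃) + (p₁ * x₂ * p₃) * (p₁ * x₂ * p₃) + (p₁ * p₂ * x₃) * (p₁ * p₂ * x₃)
          ≡ (x₁ * x₂ * x₃) * (p₁ * p₂ * p₃) + k * ((p₁ * p₂ * p₃) * (p₁ * p₂ * p₃))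

  _*≢0_ : ∀ {i j} → i ≢ 0ℤ → j ≢ 0ℤ → i * j ≢ 0ℤ
  _*≢0_ {i} i≢0 j≢0 ij≡0 = Sum.[ i≢0 , j≢0 ] (ℤ.i*j≡0⇒i≡0∨j≡0 i ij≡0)

  -- Each lemma below rewrites the cleared equation as c(a + ℓb) = c(ℓd), where c·a collects its
  -- terms of least ℓ-adic valuation when the pᵢ are powers of ℓ; the three lemmas are the cases
  -- v(p₁) > v(p₂p₃), v(p₁) < v(p₂p₃) and v(p₁) = v(p₂p₃).
  module _ (ℓ : ℤ) where

    scaled⇒∣ : ∀ {c} a {b d} → c ≢ 0ℤ → c * (a + ℓ * b) ≡ c * (ℓ * d) → ℓ ∣ a
    scaled⇒∣ {c} a {b} {d} c≢0 eq =
      Signed.∣⇒∣ᵤ (Signed.∣m+n∣n⇒∣m {m = a} ℓ∣a+ℓb (Signed.∣m⇒∣m*n b Signed.∣-refl))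
      where
      ℓ∣a+ℓb : Signed._∣_ ℓ (a + ℓ * b)
      ℓ∣a+ℓb = subst (Signed._∣_ ℓ) (sym (ℤ.*-cancelˡ-≡ c _ _ {{ℤ.≢-nonZero c≢0}} eq))
                     (Signed.∣m⇒∣m*n d Signed.∣-refl)

    excess⇒∣x₁² : ∀ {k x₁ x₂ x₃ p₁ p₂ p₃} q → p₂ ≢ 0ℤ → p₃ ≢ 0ℤ →
      p₁ ≡ ℓ * (p₂ * p₃) * q → ClearedMarkoffEq k x₁ p₁ x₂ p₂ x₃ p₃ → ℓ ∣ x₁ * x₁
    excess⇒∣x₁² {k} {x₁} {x₂} {x₃} {_} {p₂} {p₃} q p₂≢0 p₃≢0 refl (cleared eq) =
      scaled⇒∣ (x₁ * x₁)
        {b = ℓ * q * q * (x₂ * x₂ * (p₃ * p₃) + x₃ * x₃ * (p₂ * p₂))}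
        {d = q * (x₁ * x₂ * x₃ + k * ℓ * q * (p₂ * p₂) * (p₃ * p₃))}
        ((p₂≢0 *≢0 p₃≢0) *≢0 (p₂≢0 *≢0 p₃≢0))
        (reshape eq (solve (k ∷ x₁ ∷ x₂ ∷ x₃ ∷ ℓ ∷ q ∷ p₂ ∷ p₃ ∷ []))
                    (solve (k ∷ x₁ ∷ x₂ ∷ x₃ ∷ ℓ ∷ q ∷ p₂ ∷ p₃ ∷ [])))

    deficit⇒∣x₁x₂x₃ : ∀ {k x₁ x₂ x₃ p₁ p₂ p₃ r s t} → ℓ ≢ 0ℤ → r ≢ 0ℤ → s ≢ 0ℤ → t ≢ 0ℤ →
      p₁ ≡ p₂ * s → p₂ ≡ p₃ * r → p₃ ≡ ℓ * s * t → ClearedMarkoffEq k x₁ p₁ x₂ p₂ x₃ p₃ →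
      ℓ ∣ x₁ * x₂ * x₃
    deficit⇒∣x₁x₂x₃ {k} {x₁} {x₂} {x₃} {_} {_} {_} {r} {s} {t}
                    ℓ≢0 r≢0 s≢0 t≢0 refl refl refl (cleared eq) =
      scaled⇒∣ (x₁ * x₂ * x₃)
        {b = k * (ℓ * ℓ) * (s * s * (s * s)) * (t * t * t) * (r * r)}
        {d = t * (x₁ * x₁ + s * s * (x₂ * x₂) + s * s * (r * r) * (x₃ * x₃))}
        (let p₃≢0 = (ℓ≢0 *≢0 s≢0) *≢0 t≢0 in
         (((p₃≢0 *≢0 r≢0) *≢0 s≢0) *≢0 (p₃≢0 *≢0 r≢0)) *≢0 p₃≢0)
        (reshape (sym eq) (solve (k ∷ x₁ ∷ x₂ ∷ x₃ ∷ ℓ ∷ r ∷ s ∷ t ∷ []))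
                          (solve (k ∷ x₁ ∷ x₂ ∷ x₃ ∷ ℓ ∷ r ∷ s ∷ t ∷ [])))

    balanced⇒∣x₁[x₂x₃-x₁] : ∀ {k x₁ x₂ x₃ p₁ p₂ p₃ q₂ q₃} → ℓ ≢ 0ℤ → q₂ ≢ 0ℤ → q₃ ≢ 0ℤ →
      p₁ ≡ p₂ * p₃ → p₂ ≡ ℓ * q₂ → p₃ ≡ ℓ * q₃ → ClearedMarkoffEq k x₁ p₁ x₂ p₂ x₃ p₃ →
      ℓ ∣ x₁ * (x₂ * x₃ - x₁)
    balanced⇒∣x₁[x₂x₃-x₁] {k} {x₁} {x₂} {x₃} {_} {_} {_} {q₂} {q₃}
                          ℓ≢0 q₂≢0 q₃≢0 refl refl refl (cleared eq) =
      scaled⇒∣ (x₁ * (x₂ * x₃ - x₁))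
        {b = k * (ℓ * ℓ * ℓ) * (q₂ * q₂) * (q₃ * q₃)}
        {d = ℓ * (x₂ * x₂ * (q₃ * q₃) + x₃ * x₃ * (q₂ * q₂))}
        (let p₁≢0 = (ℓ≢0 *≢0 q₂≢0) *≢0 (ℓ≢0 *≢0 q₃≢0) in p₁≢0 *≢0 p₁≢0)
        (reshape (cong (_- ℓ * q₂ * (ℓ * q₃) * (ℓ * q₂ * (ℓ * q₃)) * (x₁ * x₁)) (sym eq))
                 (solve (k ∷ x₁ ∷ x₂ ∷ x₃ ∷ ℓ ∷ q₂ ∷ q₃ ∷ []))
                 (solve (k ∷ x₁ ∷ x₂ ∷ x₃ ∷ ℓ ∷ q₂ ∷ q₃ ∷ [])))

open ClearedEquation
open import Data.Rational using (ℚ; _+_; _*_; _-_; -_)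

ofℤ≡mkℚ : ∀ a → ofℤ a ≡ ℚ.mkℚ a 0 (Coprimality.sym (Coprimality.1-coprimeTo ℤ.∣ a ∣))
ofℤ≡mkℚ a = ℚ.↥p/↧p≡p (ℚ.mkℚ a 0 (Coprimality.sym (Coprimality.1-coprimeTo ℤ.∣ a ∣)))

ofℤ-injective : ∀ {a b} → ofℤ a ≡ ofℤ b → a ≡ b
ofℤ-injective {a} {b} eq = cong ℚ.↥_ (trans (sym (ofℤ≡mkℚ a)) (trans eq (ofℤ≡mkℚ b)))

ofℤ-homo-* : ∀ a b → ofℤ (a ℤ.* b) ≡ ofℤ a * ofℤ b
ofℤ-homo-* a b = sym (cong₂ _*_ (ofℤ≡mkℚ a) (ofℤ≡mkℚ b))

ofℤ-homo-+ : ∀ a b → ofℤ (a ℤ.+ b) ≡ ofℤ a + ofℤ b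
ofℤ-homo-+ a b = trans (cong ofℤ (sym (cong₂ ℤ._+_ (ℤ.*-identityʳ a) (ℤ.*-identityʳ b))))
                       (sym (cong₂ _+_ (ofℤ≡mkℚ a) (ofℤ≡mkℚ b)))

ofℤ-homo‿- : ∀ a → ofℤ (ℤ.- a) ≡ - ofℤ a
ofℤ-homo‿- +0       = refl
ofℤ-homo‿- +[1+ n ] = refl
ofℤ-homo‿- -[1+ n ] = trans (ofℤ≡mkℚ +[1+ n ]) (cong -_ (sym (ofℤ≡mkℚ -[1+ n ])))

ofℤ-homo-minus : ∀ a b → ofℤ (a ℤ.- b) ≡ ofℤ a - ofℤ b
ofℤ-homo-minus a b = trans (ofℤ-homo-+ a (ℤ.- b)) (cong (_+_ (ofℤ a)) (ofℤ-homo‿- b))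

*-cancelˡ-≡-pos : ∀ r {p q} .{{_ : ℚ.Positive r}} → r * p ≡ r * q → p ≡ q
*-cancelˡ-≡-pos r eq =
  ℚ.≤-antisym (ℚ.*-cancelˡ-≤-pos r (ℚ.≤-reflexive eq)) (ℚ.*-cancelˡ-≤-pos r (ℚ.≤-reflexive (sym eq)))

ℚ-ring : AlmostCommutativeRing 0ℓ 0ℓ
ℚ-ring = fromCommutativeRing ℚ.+-*-commutativeRing (λ x → dec⇒maybe (ℚ.0ℚ ℚ.≟ x))

module _ {k : ℤ} (u₁ u₂ u₃ : ℚ) (markoff : MarkoffEq k u₁ u₂ u₃) where

  markoff-swap₁₂ : MarkoffEq k u₂ u₁ u₃
  markoff-swap₁₂ = reshape markoff (RingSolver.solve (u₁ ∷ u₂ ∷ u₃ ∷ []) ℚ-ring) refl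

  markoff-swap₂₃ : MarkoffEq k u₁ u₃ u₂
  markoff-swap₂₃ = reshape markoff (RingSolver.solve (u₁ ∷ u₂ ∷ u₃ ∷ []) ℚ-ring) refl

  markoff-rotate : MarkoffEq k u₃ u₁ u₂
  markoff-rotate = reshape markoff (RingSolver.solve (u₁ ∷ u₂ ∷ u₃ ∷ []) ℚ-ring) refl

  -- u₁ and u₂u₃ - u₁ are the two roots of the Markoff equation as a quadratic in its first variable.
  markoff-vieta : MarkoffEq k (u₂ * u₃ - u₁) u₂ u₃
  markoff-vieta = reshape markoff (RingSolver.solve (u₁ ∷ u₂ ∷ u₃ ∷ []) ℚ-ring) refl

markoff⇒cleared : ∀ {K p₁ p₂ p₃ u₁ u₂ u₃ X₁ X₂ X₃} →
  p₁ * u₁ ≡ X₁ → p₂ * u₂ ≡ X₂ → p₃ * u₃ ≡ X₃ → (u₁ * u₁ + u₂ * u₂ + u₃ * u₃) - u₁ * u₂ * u₃ ≡ K →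
  (X₁ * p₂ * p₃) * (X₁ * p₂ * p₃) + (p₁ * X₂ * p₃) * (p₁ * X₂ * p₃) + (p₁ * p₂ * X₃) * (p₁ * p₂ * X₃)
    ≡ (X₁ * X₂ * X₃) * (p₁ * p₂ * p₃) + K * ((p₁ * p₂ * p₃) * (p₁ * p₂ * p₃))
markoff⇒cleared {K} {p₁} {p₂} {p₃} {u₁} {u₂} {u₃} refl refl refl markoff =
  reshape (cong (λ m → (p₁ * p₂ * p₃) * (p₁ * p₂ * p₃) * m
                       + (p₁ * u₁) * (p₂ * u₂) * (p₃ * u₃) * (p₁ * p₂ * p₃)) markoff)
          (RingSolver.solve (K ∷ p₁ ∷ p₂ ∷ p₃ ∷ u₁ ∷ u₂ ∷ u₃ ∷ []) ℚ-ring)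
          (RingSolver.solve (K ∷ p₁ ∷ p₂ ∷ p₃ ∷ u₁ ∷ u₂ ∷ u₃ ∷ []) ℚ-ring)

clear-denominators : ∀ {k x₁ p₁ x₂ p₂ x₃ p₃ u₁ u₂ u₃} →
  ofℤ p₁ * u₁ ≡ ofℤ x₁ → ofℤ p₂ * u₂ ≡ ofℤ x₂ → ofℤ p₃ * u₃ ≡ ofℤ x₃ → MarkoffEq k u₁ u₂ u₃ →
  ClearedMarkoffEq k x₁ p₁ x₂ p₂ x₃ p₃
clear-denominators {k} {x₁} {p₁} {x₂} {p₂} {x₃} {p₃} {u₁} {u₂} {u₃} e₁ e₂ e₃ markoff =
  cleared (ofℤ-injective (reshape
    (markoff⇒cleared {ofℤ k} {ofℤ p₁} {ofℤ p₂} {ofℤ p₃} {u₁} {u₂} {u₃} e₁ e₂ e₃ markoff)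
    (trans (ofℤ-homo-+ (y₁ ℤ.* y₁ ℤ.+ y₂ ℤ.* y₂) (y₃ ℤ.* y₃))
           (cong₂ _+_ (trans (ofℤ-homo-+ (y₁ ℤ.* y₁) (y₂ ℤ.* y₂))
                             (cong₂ _+_ (ofℤ-square³ x₁ p₂ p₃) (ofℤ-square³ p₁ x₂ p₃)))
                      (ofℤ-square³ p₁ p₂ x₃)))
    (sym (trans (ofℤ-homo-+ ((x₁ ℤ.* x₂ ℤ.* x₃) ℤ.* N) (k ℤ.* (N ℤ.* N)))
                (cong₂ _+_ (trans (ofℤ-homo-* (x₁ ℤ.* x₂ ℤ.* x₃) N)
                                  (cong₂ _*_ (ofℤ-homo-*³ x₁ x₂ x₃) (ofℤ-homo-*³ p₁ p₂ p₃)))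
                           (trans (ofℤ-homo-* k (N ℤ.* N))
                                  (cong (ofℤ k *_) (ofℤ-square³ p₁ p₂ p₃))))))))
  where
  y₁ y₂ y₃ N : ℤ
  y₁ = x₁ ℤ.* p₂ ℤ.* p₃
  y₂ = p₁ ℤ.* x₂ ℤ.* p₃
  y₃ = p₁ ℤ.* p₂ ℤ.* x₃
  N  = p₁ ℤ.* p₂ ℤ.* p₃

  ofℤ-homo-*³ : ∀ a b c → ofℤ (a ℤ.* b ℤ.* c) ≡ ofℤ a * ofℤ b * ofℤ c
  ofℤ-homo-*³ a b c = trans (ofℤ-homo-* (a ℤ.* b) c) (cong (_* ofℤ c) (ofℤ-homo-* a b))

  ofℤ-square³ : ∀ a b c →
    ofℤ ((a ℤ.* b ℤ.* c) ℤ.* (a ℤ.* b ℤ.* c)) ≡ (ofℤ a * ofℤ b * ofℤ c) * (ofℤ a * ofℤ b * ofℤ c)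
  ofℤ-square³ a b c =
    trans (ofℤ-homo-* (a ℤ.* b ℤ.* c) (a ℤ.* b ℤ.* c)) (cong₂ _*_ (ofℤ-homo-*³ a b c) (ofℤ-homo-*³ a b c))

vieta-numerator : ∀ {p₁ p₂ p₃ u₁ u₂ u₃ X₁ X₂ X₃} →
  p₁ ≡ p₂ * p₃ → p₁ * u₁ ≡ X₁ → p₂ * u₂ ≡ X₂ → p₃ * u₃ ≡ X₃ → p₁ * (u₂ * u₃ - u₁) ≡ X₂ * X₃ - X₁
vieta-numerator {p₂ = p₂} {p₃} {u₁} {u₂} {u₃} refl refl refl refl =
  RingSolver.solve (p₂ ∷ p₃ ∷ u₁ ∷ u₂ ∷ u₃ ∷ []) ℚ-ring

module ReducedForm (ℓ : ℕ) .{{_ : ℕ.NonZero ℓ}} where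

  ℓ^_ : ℕ → ℤ
  ℓ^ d = + (ℓ ℕ.^ d)

  ℓ^-+ : ∀ m n → ℓ^ (m ℕ.+ n) ≡ ℓ^ m ℤ.* ℓ^ n
  ℓ^-+ m n = trans (cong +_ (ℕ.^-distribˡ-+-* ℓ m n)) (ℤ.pos-* (ℓ ℕ.^ m) (ℓ ℕ.^ n))

  ℓ^-suc : ∀ n → ℓ^ (suc n) ≡ + ℓ ℤ.* ℓ^ n
  ℓ^-suc n = ℤ.pos-* ℓ (ℓ ℕ.^ n)

  ℓ^-+≡ : ∀ m o {n} → m ℕ.+ o ≡ n → ℓ^ n ≡ ℓ^ m ℤ.* ℓ^ o
  ℓ^-+≡ m o refl = ℓ^-+ m o

  ℓ^-suc-+≡ : ∀ m o {n} → suc m ℕ.+ o ≡ n → ℓ^ n ≡ + ℓ ℤ.* ℓ^ m ℤ.* ℓ^ o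
  ℓ^-suc-+≡ m o refl = trans (ℓ^-+ (suc m) o) (cong (ℤ._* ℓ^ o) (ℓ^-suc m))

  ℓ≢0 : + ℓ ≢ 0ℤ
  ℓ≢0 eq = ℕ.≢-nonZero⁻¹ ℓ (ℤ.+-injective eq)

  ℓ^≢0 : ∀ d → ℓ^ d ≢ 0ℤ
  ℓ^≢0 d eq = ℕ.≢-nonZero⁻¹ (ℓ ℕ.^ d) {{ℕ.m^n≢0 ℓ d}} (ℤ.+-injective eq)

  divide-out-ℓ : ∀ {e u x} → + ℓ ∣ x → pow ℓ (suc e) * u ≡ ofℤ x → ∃[ y ] pow ℓ e * u ≡ ofℤ y
  divide-out-ℓ {e} {u} {x} ℓ∣x eq with Signed.∣ᵤ⇒∣ {+ ℓ} {x} ℓ∣x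
  ... | Signed.divides y refl = y , *-cancelˡ-≡-pos (ofℤ (+ ℓ)) {{ℚ.normalize-pos ℓ 1}} (begin
    ofℤ (+ ℓ) * (pow ℓ e * u)  ≡⟨ ℚ.*-assoc (ofℤ (+ ℓ)) (pow ℓ e) u ⟨
    ofℤ (+ ℓ) * pow ℓ e * u    ≡⟨ cong (_* u) (ofℤ-homo-* (+ ℓ) (ℓ^ e)) ⟨
    ofℤ (+ ℓ ℤ.* ℓ^ e) * u     ≡⟨ cong (λ p → ofℤ p * u) (ℓ^-suc e) ⟨
    pow ℓ (suc e) * u          ≡⟨ eq ⟩
    ofℤ (y ℤ.* + ℓ)            ≡⟨ cong ofℤ (ℤ.*-comm y (+ ℓ)) ⟩
    ofℤ (+ ℓ ℤ.* y)            ≡⟨ ofℤ-homo-* (+ ℓ) y ⟩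
    ofℤ (+ ℓ) * ofℤ y          ∎)
    where open ≡-Reasoning

  record Reduced (u : ℚ) : Set where
    constructor reduced
    field
      exponent  : ℕ
      numerator : ℤ
      scaling   : pow ℓ exponent * u ≡ ofℤ numerator
      coprime   : exponent ≥ 1 → ¬ (+ ℓ ∣ numerator)

  reduce : ∀ {u} e x → pow ℓ e * u ≡ ofℤ x → Σ (Reduced u) λ r → Reduced.exponent r ≤ e
  reduce zero x eq = reduced zero x eq (λ ()) , z≤n
  reduce {u} (suc e) x eq with ℓ ℕ.∣? ℤ.∣ x ∣
  ... | no ℓ∤x = reduced (suc e) x eq (λ _ → ℓ∤x) , ℕ.≤-refl
  ... | yes ℓ∣x with y , eq′ ← divide-out-ℓ {e} {u} {x} ℓ∣x eq = map₂ ℕ.m≤n⇒m≤1+n (reduce e y eq′)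

module Descent {ℓ : ℕ} (ℓ-prime : Prime ℓ) where

  private instance
    ℓ-nonZero : ℕ.NonZero ℓ
    ℓ-nonZero = prime⇒nonZero ℓ-prime

  open ReducedForm ℓ

  euclid : ∀ a b → + ℓ ∣ a ℤ.* b → + ℓ ∣ a ⊎ + ℓ ∣ b
  euclid a b ℓ∣ab = euclidsLemma ℤ.∣ a ∣ ℤ.∣ b ∣ ℓ-prime (subst (ℓ ℕ.∣_) (ℤ.abs-* a b) ℓ∣ab)

  ∤∧∤⇒∤* : ∀ a b → ¬ (+ ℓ ∣ a) → ¬ (+ ℓ ∣ b) → ¬ (+ ℓ ∣ a ℤ.* b)
  ∤∧∤⇒∤* a b ℓ∤a ℓ∤b ℓ∣ab = Sum.[ ℓ∤a , ℓ∤b ] (euclid a b ℓ∣ab)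

  module _ (k : ℤ) where

    record Point : Set where
      constructor point
      field
        u₁ u₂ u₃ : ℚ
        r₁ : Reduced u₁
        r₂ : Reduced u₂
        r₃ : Reduced u₃
        markoff : MarkoffEq k u₁ u₂ u₃

    open Point
    open Reduced

    d₁ d₂ d₃ depth : Point → ℕ
    d₁ p = exponent (r₁ p)
    d₂ p = exponent (r₂ p)
    d₃ p = exponent (r₃ p)
    depth p = d₁ p ℕ.+ d₂ p ℕ.+ d₃ p

    _≺_ : Point → Point → Set
    p ≺ q = depth p < depth q

    ≺-wellFounded : WellFounded _≺_
    ≺-wellFounded = On.wellFounded depth <-wellFounded

    Conclusion : Set
    Conclusion = (∃[ x₁ ] ∃[ x₂ ] ∃[ x₃ ] InM ℓ k (ofℤ x₁) (ofℤ x₂) (ofℤ x₃))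
      ⊎ (∃[ a ] ∃[ x₁ ] ∃[ x₂ ] ∃[ x₃ ] ∃[ u₂ ] ∃[ u₃ ]
           (a ≥ 1 × ¬ (+ ℓ ∣ x₂ ℤ.* x₃)
            × pow ℓ a * u₂ ≡ ofℤ x₂ × pow ℓ a * u₃ ≡ ofℤ x₃
            × InM ℓ k (ofℤ x₁) u₂ u₃))

    swap₁₂ swap₂₃ rotate : Point → Point
    swap₁₂ p = point (u₂ p) (u₁ p) (u₃ p) (r₂ p) (r₁ p) (r₃ p)
                     (markoff-swap₁₂ {k} (u₁ p) (u₂ p) (u₃ p) (markoff p))
    swap₂₃ p = point (u₁ p) (u₃ p) (u₂ p) (r₁ p) (r₃ p) (r₂ p)
                     (markoff-swap₂₃ {k} (u₁ p) (u₂ p) (u₃ p) (markoff p))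
    rotate p = point (u₃ p) (u₁ p) (u₂ p) (r₃ p) (r₁ p) (r₂ p)
                     (markoff-rotate {k} (u₁ p) (u₂ p) (u₃ p) (markoff p))

    depth-swap₁₂ : ∀ p → depth (swap₁₂ p) ≡ depth p
    depth-swap₁₂ (point _ _ _ r₁ r₂ r₃ _) = xy∙z≈yx∙z (exponent r₂) (exponent r₁) (exponent r₃)

    depth-swap₂₃ : ∀ p → depth (swap₂₃ p) ≡ depth p
    depth-swap₂₃ (point _ _ _ r₁ r₂ r₃ _) = xy∙z≈xz∙y (exponent r₁) (exponent r₃) (exponent r₂)

    depth-rotate : ∀ p → depth (rotate p) ≡ depth p
    depth-rotate (point _ _ _ r₁ r₂ r₃ _) = xy∙z≈yz∙x (exponent r₃) (exponent r₁) (exponent r₂)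

    Sorted : Point → Set
    Sorted p = d₂ p ≤ d₁ p × d₃ p ≤ d₂ p

    SortedRearrangement : Point → Set
    SortedRearrangement p = Σ Point λ q → depth q ≡ depth p × Sorted q

    insert₃ : (p : Point) → d₂ p ≤ d₁ p → SortedRearrangement p
    insert₃ p d₂≤d₁ with d₃ p ℕ.≤? d₂ p | d₃ p ℕ.≤? d₁ p
    ... | yes d₃≤d₂ | _         = p , refl , d₂≤d₁ , d₃≤d₂
    ... | no d₃≰d₂  | yes d₃≤d₁ = swap₂₃ p , depth-swap₂₃ p , d₃≤d₁ , ℕ.<⇒≤ (ℕ.≰⇒> d₃≰d₂)
    ... | no _      | no d₃≰d₁  = rotate p , depth-rotate p , ℕ.<⇒≤ (ℕ.≰⇒> d₃≰d₁) , d₂≤d₁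

    rearrange : ∀ {p q} → depth q ≡ depth p → SortedRearrangement q → SortedRearrangement p
    rearrange depth-q (r , depth-r , sorted) = r , trans depth-r depth-q , sorted

    sort : (p : Point) → SortedRearrangement p
    sort p with d₂ p ℕ.≤? d₁ p
    ... | yes d₂≤d₁ = insert₃ p d₂≤d₁
    ... | no d₂≰d₁ = rearrange {p} {swap₁₂ p} (depth-swap₁₂ p) (insert₃ (swap₁₂ p) (ℕ.<⇒≤ (ℕ.≰⇒> d₂≰d₁)))

    x₁ x₂ x₃ : Point → ℤ
    x₁ p = numerator (r₁ p)
    x₂ p = numerator (r₂ p)
    x₃ p = numerator (r₃ p)

    point-cleared : (p : Point) → ClearedMarkoffEq k (x₁ p) (ℓ^ d₁ p) (x₂ p) (ℓ^ d₂ p) (x₃ p) (ℓ^ d₃ p)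
    point-cleared p =
      clear-denominators {k} {x₁ p} {ℓ^ d₁ p} {x₂ p} {ℓ^ d₂ p} {x₃ p} {ℓ^ d₃ p} {u₁ p} {u₂ p} {u₃ p}
        (scaling (r₁ p)) (scaling (r₂ p)) (scaling (r₃ p)) (markoff p)

    markoff-subst : ∀ {u₁ u₂ u₃ v₁ v₂ v₃} → u₁ ≡ v₁ → u₂ ≡ v₂ → u₃ ≡ v₃ →
      MarkoffEq k u₁ u₂ u₃ → MarkoffEq k v₁ v₂ v₃
    markoff-subst refl refl refl m = m

    integral : ∀ x → InZ[1/ ℓ ] (ofℤ x)
    integral x = 0 , x , ℚ.*-identityˡ (ofℤ x)

    unscaled : ∀ u x → pow ℓ 0 * u ≡ ofℤ x → u ≡ ofℤ x
    unscaled u _ eq = trans (sym (ℚ.*-identityˡ u)) eq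

    excess-impossible : (p : Point) → d₂ p ℕ.+ d₃ p < d₁ p → ⊥
    excess-impossible p@(point _ _ _ (reduced d₁ x₁ _ c₁) (reduced d₂ _ _ _) (reduced d₃ _ _ _) _) d₂+d₃<d₁
      with o , 1+d₂+d₃+o≡d₁ ← ℕ.m≤n⇒∃[o]m+o≡n d₂+d₃<d₁ =
      c₁ (ℕ.≤-trans (s≤s z≤n) d₂+d₃<d₁) (Sum.reduce (euclid x₁ x₁ ℓ∣x₁²))
      where
      ℓ∣x₁² : + ℓ ∣ x₁ ℤ.* x₁
      ℓ∣x₁² = excess⇒∣x₁² (+ ℓ) (ℓ^ o) (ℓ^≢0 d₂) (ℓ^≢0 d₃)
        (trans (ℓ^-suc-+≡ (d₂ ℕ.+ d₃) o 1+d₂+d₃+o≡d₁) (cong (λ q → + ℓ ℤ.* q ℤ.* ℓ^ o) (ℓ^-+ d₂ d₃)))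
        (point-cleared p)

    deficit-impossible : (p : Point) → Sorted p → d₁ p < d₂ p ℕ.+ d₃ p → ⊥
    deficit-impossible p@(point _ _ _ (reduced d₁ x₁ _ c₁) (reduced d₂ x₂ _ c₂) (reduced d₃ x₃ _ c₃) _)
                       (d₂≤d₁ , d₃≤d₂) d₁<d₂+d₃
      with s , d₂+s≡d₁ ← ℕ.m≤n⇒∃[o]m+o≡n d₂≤d₁
         | r , d₃+r≡d₂ ← ℕ.m≤n⇒∃[o]m+o≡n d₃≤d₂ =
      let s<d₃ = ℕ.+-cancelˡ-< d₂ s d₃ (subst (_< d₂ ℕ.+ d₃) (sym d₂+s≡d₁) d₁<d₂+d₃)
          t , 1+s+t≡d₃ = ℕ.m≤n⇒∃[o]m+o≡n s<d₃
          1≤d₃ = ℕ.m<n⇒0<n s<d₃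
          1≤d₂ = ℕ.≤-trans 1≤d₃ d₃≤d₂
      in ∤∧∤⇒∤* (x₁ ℤ.* x₂) x₃ (∤∧∤⇒∤* x₁ x₂ (c₁ (ℕ.≤-trans 1≤d₂ d₂≤d₁)) (c₂ 1≤d₂)) (c₃ 1≤d₃)
           (deficit⇒∣x₁x₂x₃ (+ ℓ) ℓ≢0 (ℓ^≢0 r) (ℓ^≢0 s) (ℓ^≢0 t)
             (ℓ^-+≡ d₂ s d₂+s≡d₁) (ℓ^-+≡ d₃ r d₃+r≡d₂) (ℓ^-suc-+≡ s t 1+s+t≡d₃) (point-cleared p))

    integral-third : (p : Point) → d₃ p ≡ 0 → d₁ p ≡ d₂ p → Conclusion
    integral-third (point u₁ u₂ u₃ (reduced zero x₁ e₁ _) (reduced _ x₂ e₂ _) (reduced _ x₃ e₃ _) m)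
                   refl refl =
      inj₁ (x₁ , x₂ , x₃ , integral x₁ , integral x₂ , integral x₃ ,
            markoff-subst (unscaled u₁ x₁ e₁) (unscaled u₂ x₂ e₂) (unscaled u₃ x₃ e₃) m)
    integral-third (point u₁ u₂ u₃ (reduced (suc a) x₁ e₁ c₁) (reduced _ x₂ e₂ c₂) (reduced _ x₃ e₃ _) m)
                   refl refl =
      inj₂ (suc a , x₃ , x₁ , x₂ , u₁ , u₂ , s≤s z≤n , ∤∧∤⇒∤* x₁ x₂ (c₁ (s≤s z≤n)) (c₂ (s≤s z≤n)) ,
            e₁ , e₂ ,
            integral x₃ , (suc a , x₁ , e₁) , (suc a , x₂ , e₂) ,
            markoff-subst (unscaled u₃ x₃ e₃) refl refl (markoff-rotate {k} u₁ u₂ u₃ m))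

    vieta-jump : (p : Point) → d₁ p ≡ d₂ p ℕ.+ d₃ p → d₂ p ≥ 1 → d₃ p ≥ 1 → Σ Point (_≺ p)
    vieta-jump (point _ _ _ _ (reduced zero _ _ _) _ _) _ () _
    vieta-jump (point _ _ _ _ (reduced (suc _) _ _ _) (reduced zero _ _ _) _) _ _ ()
    vieta-jump p@(point u₁ u₂ u₃ (reduced _ x₁ e₁ c₁) r₂@(reduced (suc b) x₂ e₂ _)
                        r₃@(reduced (suc c) x₃ e₃ _) m) refl _ _ =
      point (u₂ * u₃ - u₁) u₂ u₃ (proj₁ jumped) r₂ r₃ (markoff-vieta {k} u₁ u₂ u₃ m) ,
      ℕ.+-monoˡ-< (suc c) (ℕ.+-monoˡ-< (suc b) (s≤s (proj₂ jumped)))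
      where
      ℓ∣x₂x₃-x₁ : + ℓ ∣ x₂ ℤ.* x₃ ℤ.- x₁
      ℓ∣x₂x₃-x₁ = Sum.fromInj₂ (λ ℓ∣x₁ → ⊥-elim (c₁ (s≤s z≤n) ℓ∣x₁)) (euclid x₁ (x₂ ℤ.* x₃ ℤ.- x₁)
        (balanced⇒∣x₁[x₂x₃-x₁] (+ ℓ) ℓ≢0 (ℓ^≢0 b) (ℓ^≢0 c)
           (ℓ^-+ (suc b) (suc c)) (ℓ^-suc b) (ℓ^-suc c) (point-cleared p)))

      scaled : pow ℓ (suc b ℕ.+ suc c) * (u₂ * u₃ - u₁) ≡ ofℤ (x₂ ℤ.* x₃ ℤ.- x₁)
      scaled =
        trans (vieta-numerator {pow ℓ (suc b ℕ.+ suc c)} {pow ℓ (suc b)} {pow ℓ (suc c)} {u₁} {u₂} {u₃}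
                 (trans (cong ofℤ (ℓ^-+ (suc b) (suc c))) (ofℤ-homo-* (ℓ^ suc b) (ℓ^ suc c))) e₁ e₂ e₃)
              (sym (trans (ofℤ-homo-minus (x₂ ℤ.* x₃) x₁) (cong (_- ofℤ x₁) (ofℤ-homo-* x₂ x₃))))

      jumped : Σ (Reduced (u₂ * u₃ - u₁)) λ r → exponent r ≤ b ℕ.+ suc c
      jumped =
        let y , scaled′ = divide-out-ℓ {b ℕ.+ suc c} {u₂ * u₃ - u₁} {x₂ ℤ.* x₃ ℤ.- x₁} ℓ∣x₂x₃-x₁ scaled
        in reduce (b ℕ.+ suc c) y scaled′

    balanced : (p : Point) → Sorted p → d₁ p ≡ d₂ p ℕ.+ d₃ p → (∀ {q} → q ≺ p → Conclusion) → Conclusion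
    balanced p@(point _ _ _ _ _ (reduced zero _ _ _) _) _ d₁≡d₂+0 _ =
      integral-third p refl (trans d₁≡d₂+0 (ℕ.+-identityʳ (d₂ p)))
    balanced p@(point _ _ _ _ _ (reduced (suc _) _ _ _) _) (_ , d₃≤d₂) d₁≡d₂+d₃ ih =
      let q , q≺p = vieta-jump p d₁≡d₂+d₃ (ℕ.≤-trans (s≤s z≤n) d₃≤d₂) (s≤s z≤n) in ih {q} q≺p

    descend : (p : Point) → Sorted p → (∀ {q} → q ≺ p → Conclusion) → Conclusion
    descend p sorted ih with ℕ.<-cmp (d₁ p) (d₂ p ℕ.+ d₃ p)
    ... | tri< d₁<d₂+d₃ _ _ = ⊥-elim (deficit-impossible p sorted d₁<d₂+d₃)
    ... | tri≈ _ d₁≡d₂+d₃ _ = balanced p sorted d₁≡d₂+d₃ (λ {q} → ih {q})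
    ... | tri> _ _ d₂+d₃<d₁ = ⊥-elim (excess-impossible p d₂+d₃<d₁)

    point-of-solution : ∀ {u₁ u₂ u₃} → InM ℓ k u₁ u₂ u₃ → Point
    point-of-solution {u₁} {u₂} {u₃} ((e₁ , x₁ , s₁) , (e₂ , x₂ , s₂) , (e₃ , x₃ , s₃) , m) =
      point u₁ u₂ u₃ (proj₁ (reduce e₁ x₁ s₁)) (proj₁ (reduce e₂ x₂ s₂)) (proj₁ (reduce e₃ x₃ s₃)) m

    markoff-descent : Point → Conclusion
    markoff-descent = All.wfRec ≺-wellFounded 0ℓ (λ _ → Conclusion) step
      where
      step : ∀ p → (∀ {q} → q ≺ p → Conclusion) → Conclusion
      step p ih =
        let q , depth-q , sorted = sort p
        in descend q sorted (λ {r} r≺q → ih {r} (subst (depth r <_) depth-q r≺q))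

lemma5p5 : (ℓ : ℕ) → Prime ℓ → 5 ≤ ℓ → (k : ℤ) →
    (∃[ u₁ ] ∃[ u₂ ] ∃[ u₃ ] InM ℓ k u₁ u₂ u₃) →
    (∃[ x₁ ] ∃[ x₂ ] ∃[ x₃ ] InM ℓ k (ofℤ x₁) (ofℤ x₂) (ofℤ x₃))
    ⊎ (∃[ a ] ∃[ x₁ ] ∃[ x₂ ] ∃[ x₃ ] ∃[ u₂ ] ∃[ u₃ ]
         (a ≥ 1 × ¬ (+ ℓ ∣ x₂ ℤ.* x₃)
          × pow ℓ a * u₂ ≡ ofℤ x₂ × pow ℓ a * u₃ ≡ ofℤ x₃
          × InM ℓ k (ofℤ x₁) u₂ u₃))
lemma5p5 ℓ ℓ-prime _ k (_ , _ , _ , solution) = markoff-descent k (point-of-solution k solution)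
  where open Descent ℓ-prime
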